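{- Let $n\ge 0$ be an integer and let $S_1,S_2,\dots,S_{2^n}$ be the $2^n$ subsets of $\{y_1,\dots,y_n\}$. Let $G$ be an SP-game with legal complex $\Delta_G=\langle\{x_1\}\cup S_1,\{x_2\}\cup S_2,\dots,\{x_{2^n}\}\cup S_{2^n}\rangle$, where the $x_i$ are Left vertices and the $y_j$ are Right vertices. Then $G$ has value $\frac{1}{2^n}$.
   Context: Games are two-player (Left, Right) short combinatorial games under normal play; value means game value (equivalence class under $G=H$ iff $G-H$ is a second-player win). An SP-game is a placement game on an initially empty board in which pieces are never moved or removed and in which any sequence of moves leading to a reachable position consists of legal moves. Its legal complex $\Delta_G$ has one vertex per basic position (single-piece position), Left basic positions written $x_i$ and Right ones $y_j$, with a set of vertices a face iff the corresponding pieces together form a legal position; from the position corresponding to face $F$, Left (resp. Right) may move to $F\cup\{v\}$ for any Left (resp. Right) vertex $v\notin F$ with $F\cup\{v\}\in\Delta_G$. $\langle F_1,\dots,F_k\rangle$ denotes the simplicial complex with facets $F_1,\dots,F_k$. Games: $0=\{\,\mid\,\}$, $1=\{0\mid\,\}$, and recursively $\frac{1}{2^n}=\{0\mid \frac{1}{2^{n-1}}\}$. -}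

module Defs where

open import Data.Nat using (ℕ; zero; suc; _+_)
open import Data.Fin using (Fin; splitAt)
open import Data.Fin.Subset using (Subset; _∈_; _⊆_; _∪_; ⁅_⁆; ⊥)
open import Data.Fin.Subset.Properties using (_∈?_; _⊆?_)
open import Data.Fin.Properties using (any?)
open import Data.List using (List; filter; length; lookup; allFin)
open import Data.Sum using (_⊎_; inj₁; inj₂; [_,_])
open import Data.Product using (_×_; _,_; proj₁; proj₂; ∃)
open import Relation.Nullary using (Dec; ¬?)
open import Relation.Nullary.Decidable using (_×-dec_)

-- Short combinatorial games:  mk m L k R  =  { L 0 , … , L (m-1) | R 0 , … , R (k-1) }

data Game : Set where
  mk : (m : ℕ) → (Fin m → Game) → (k : ℕ) → (Fin k → Game) → Game

neg : Game → Game
neg (mk m L k R) = mk k (λ j → neg (R j)) m (λ i → neg (L i))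

-- disjunctive sum:  G + H = { G^L + H , G + H^L | G^R + H , G + H^R }
infixl 6 _⊕_
_⊕_ : Game → Game → Game
mk m L k R ⊕ mk m' L' k' R' =
  mk (m + m')
     (λ i → [ (λ a → L a ⊕ mk m' L' k' R') , (λ b → mk m L k R ⊕ L' b) ] (splitAt m i))
     (k + k')
     (λ j → [ (λ a → R a ⊕ mk m' L' k' R') , (λ b → mk m L k R ⊕ R' b) ] (splitAt k j))

LeftWinsFirst LeftWinsSecond RightWinsFirst RightWinsSecond : Game → Set
LeftWinsFirst (mk m L k R) = ∃ λ (i : Fin m) → LeftWinsSecond (L i)
LeftWinsSecond (mk m L k R) = (j : Fin k) → LeftWinsFirst (R j)
RightWinsFirst (mk m L k R) = ∃ λ (j : Fin k) → RightWinsSecond (R j)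
RightWinsSecond (mk m L k R) = (i : Fin m) → RightWinsFirst (L i)

SecondPlayerWin : Game → Set
SecondPlayerWin G = LeftWinsSecond G × RightWinsSecond G

infix 4 _≈G_
_≈G_ : Game → Game → Set
G ≈G H = SecondPlayerWin (G ⊕ neg H)

zeroG : Game
zeroG = mk 0 (λ ()) 0 (λ ())

dyadic : ℕ → Game       -- dyadic n = 1 / 2^n
dyadic zero = mk 1 (λ _ → zeroG) 0 (λ ())
dyadic (suc n) = mk 1 (λ _ → zeroG) 1 (λ _ → dyadic n)

-- Legal complexes of SP-games.
-- Left vertices x_i are Fin nL, Right vertices y_j are Fin nR; a set of vertices
-- is a pair (X , Y) of a set of Left vertices and a set of Right vertices.

record Complex : Set₁ where
  field
    nL nR   : ℕ
    IsFace  : Subset nL → Subset nR → Set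
    isFace? : ∀ X Y → Dec (IsFace X Y)

⟨_⟩ : ∀ {a b k} → (Fin k → Subset a × Subset b) → Complex
⟨_⟩ {a} {b} {k} F = record
  { nL = a ; nR = b
  ; IsFace = λ X Y → ∃ λ (j : Fin k) → X ⊆ proj₁ (F j) × Y ⊆ proj₂ (F j)
  ; isFace? = λ X Y → any? (λ j → (X ⊆? proj₁ (F j)) ×-dec (Y ⊆? proj₂ (F j)))
  }

-- The ℕ argument is fuel; starting with fuel nL + nR it never runs out before
-- all vertices are used (each move adds a new vertex), so it does not truncate.
module _ (C : Complex) where
  open Complex C

  gameFrom : ℕ → Subset nL → Subset nR → Game
  gameFrom zero X Y = zeroG
  gameFrom (suc f) X Y =
    mk (length ls) (λ i → gameFrom f (X ∪ ⁅ lookup ls i ⁆) Y)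
       (length rs) (λ j → gameFrom f X (Y ∪ ⁅ lookup rs j ⁆))
    where
    ls : List (Fin nL)
    ls = filter (λ x → ¬? (x ∈? X) ×-dec isFace? (X ∪ ⁅ x ⁆) Y) (allFin nL)
    rs : List (Fin nR)
    rs = filter (λ y → ¬? (y ∈? Y) ×-dec isFace? X (Y ∪ ⁅ y ⁆)) (allFin nR)

  spGame : Game
  spGame = gameFrom (nL + nR) ⊥ ⊥

-- Let Y be the set of Right pieces on the board while no Left piece has been
-- played, and let m be the number of Right vertices missing from Y.  Then the
-- position is worth 1/2^m = {0 | 1/2^(m-1)}.  Left's only options are the
-- moves to some {x_i} ∪ Y, after which Left never moves again, so they are
-- worth at most 0; playing the x_i with S_i = Y is worth exactly 0 since then
-- Right has no move either.  Right's options add a missing y_j, keeping a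
-- facet {x_i} ∪ S_i above (take S_i = Y ∪ {y_j}), and are worth 1/2^(m-1) by
-- induction.  Surjectivity of i ↦ S_i is all that is used.
module Submission where

open import Defs
open import Data.Nat using (ℕ; zero; suc; _+_; _^_; _≤_; _<_; s≤s)
open import Data.Nat.Properties using (suc-injective; m<n+m; m^n>0)
open import Data.Fin using (Fin; zero; suc; splitAt; _↑ˡ_; _↑ʳ_)
open import Data.Fin.Properties using (splitAt-↑ˡ; splitAt-↑ʳ)
open import Data.Fin.Subset using (Subset; inside; outside; _∈_; _∉_; _⊆_; _∪_; ⁅_⁆; ⊥; ∁; ∣_∣)
open import Data.Fin.Subset.Properties
  using (_∈?_; ∉⊥; x∈⁅x⁆; x∈⁅y⁆⇒x≡y; p⊆p∪q; q⊆p∪q; ∪-identityˡ; ∪-identityʳ; ⊆-reflexive; ⊆-min)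
open import Data.Vec using (_∷_; here; there)
open import Data.List using (allFin)
open import Data.List.Membership.Propositional.Properties using (∈-filter⁺; ∈-filter⁻; ∈-lookup; ∈-allFin)
open import Data.List.Relation.Unary.Any using (index)
open import Data.List.Relation.Unary.Any.Properties using (lookup-index)
open import Data.Sum using (inj₁; inj₂; [_,_]′)
open import Data.Product using (∃; _×_; _,_; proj₁; proj₂)
open import Data.Empty using (⊥-elim)
open import Function using (_∘_)
open import Function.Definitions using (Surjective; Bijective)
open import Relation.Nullary using (¬_; ¬?)
open import Relation.Nullary.Decidable using (_×-dec_)
open import Relation.Unary using (Decidable)
open import Relation.Binary.PropositionalEquality using (_≡_; refl; sym; trans; cong; subst)

leftMoves rightMoves : Game → ℕ
leftMoves (mk m _ _ _) = m
rightMoves (mk _ _ k _) = k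

leftOption : (G : Game) → Fin (leftMoves G) → Game
leftOption (mk _ L _ _) = L

rightOption : (G : Game) → Fin (rightMoves G) → Game
rightOption (mk _ _ _ R) = R

LeftEnd RightEnd : Game → Set
LeftEnd G = ¬ Fin (leftMoves G)
RightEnd G = ¬ Fin (rightMoves G)

[,]′-splitAt-↑ˡ : ∀ {A : Set} m n (f : Fin m → A) (g : Fin n → A) i →
                  [ f , g ]′ (splitAt m (i ↑ˡ n)) ≡ f i
[,]′-splitAt-↑ˡ m n f g i rewrite splitAt-↑ˡ m i n = refl

[,]′-splitAt-↑ʳ : ∀ {A : Set} m n (f : Fin m → A) (g : Fin n → A) i →
                  [ f , g ]′ (splitAt m (m ↑ʳ i)) ≡ g i
[,]′-splitAt-↑ʳ m n f g i rewrite splitAt-↑ʳ m n i = refl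

leftWinsFirst-⊕ˡ : ∀ G H i → LeftWinsSecond (leftOption G i ⊕ H) → LeftWinsFirst (G ⊕ H)
leftWinsFirst-⊕ˡ G@(mk m L k R) H@(mk m' L' k' R') i w =
  i ↑ˡ m' , subst LeftWinsSecond (sym ([,]′-splitAt-↑ˡ m m' (λ a → L a ⊕ H) (λ b → G ⊕ L' b) i)) w

leftWinsFirst-⊕ʳ : ∀ G H i → LeftWinsSecond (G ⊕ leftOption H i) → LeftWinsFirst (G ⊕ H)
leftWinsFirst-⊕ʳ G@(mk m L k R) H@(mk m' L' k' R') i w =
  m ↑ʳ i , subst LeftWinsSecond (sym ([,]′-splitAt-↑ʳ m m' (λ a → L a ⊕ H) (λ b → G ⊕ L' b) i)) w

rightWinsFirst-⊕ˡ : ∀ G H i → RightWinsSecond (rightOption G i ⊕ H) → RightWinsFirst (G ⊕ H)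
rightWinsFirst-⊕ˡ G@(mk m L k R) H@(mk m' L' k' R') i w =
  i ↑ˡ k' , subst RightWinsSecond (sym ([,]′-splitAt-↑ˡ k k' (λ a → R a ⊕ H) (λ b → G ⊕ R' b) i)) w

rightWinsFirst-⊕ʳ : ∀ G H i → RightWinsSecond (G ⊕ rightOption H i) → RightWinsFirst (G ⊕ H)
rightWinsFirst-⊕ʳ G@(mk m L k R) H@(mk m' L' k' R') i w =
  k ↑ʳ i , subst RightWinsSecond (sym ([,]′-splitAt-↑ʳ k k' (λ a → R a ⊕ H) (λ b → G ⊕ R' b) i)) w

leftWinsSecond-⊕ : ∀ G H →
  (∀ i → LeftWinsFirst (rightOption G i ⊕ H)) → (∀ j → LeftWinsFirst (G ⊕ rightOption H j)) →
  LeftWinsSecond (G ⊕ H)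
leftWinsSecond-⊕ (mk m L k R) (mk m' L' k' R') wG wH j with splitAt k j
... | inj₁ a = wG a
... | inj₂ b = wH b

rightWinsSecond-⊕ : ∀ G H →
  (∀ i → RightWinsFirst (leftOption G i ⊕ H)) → (∀ j → RightWinsFirst (G ⊕ leftOption H j)) →
  RightWinsSecond (G ⊕ H)
rightWinsSecond-⊕ (mk m L k R) (mk m' L' k' R') wG wH i with splitAt m i
... | inj₁ a = wG a
... | inj₂ b = wH b

leftEnd⇒rightWinsSecond-⊕-neg-zero : ∀ G → LeftEnd G → RightWinsSecond (G ⊕ neg zeroG)
leftEnd⇒rightWinsSecond-⊕-neg-zero G end = rightWinsSecond-⊕ G (neg zeroG) (⊥-elim ∘ end) λ ()

rightEnd⇒leftWinsSecond-⊕-neg-zero : ∀ G → RightEnd G → LeftWinsSecond (G ⊕ neg zeroG)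
rightEnd⇒leftWinsSecond-⊕-neg-zero G end = leftWinsSecond-⊕ G (neg zeroG) (⊥-elim ∘ end) λ ()

rightWinsFirst-⊕-neg-dyadic : ∀ G m → RightWinsSecond (G ⊕ neg zeroG) → RightWinsFirst (G ⊕ neg (dyadic m))
rightWinsFirst-⊕-neg-dyadic G zero    = rightWinsFirst-⊕ʳ G (neg (dyadic zero)) zero
rightWinsFirst-⊕-neg-dyadic G (suc m) = rightWinsFirst-⊕ʳ G (neg (dyadic (suc m))) zero

module _ (C : Complex) where
  open Complex C

  LegalLeftMove : Subset nL → Subset nR → Fin nL → Set
  LegalLeftMove X Y x = x ∉ X × IsFace (X ∪ ⁅ x ⁆) Y

  LegalRightMove : Subset nL → Subset nR → Fin nR → Set
  LegalRightMove X Y y = y ∉ Y × IsFace X (Y ∪ ⁅ y ⁆)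

  legalLeftMove? : ∀ X Y → Decidable (LegalLeftMove X Y)
  legalLeftMove? X Y x = ¬? (x ∈? X) ×-dec isFace? (X ∪ ⁅ x ⁆) Y

  legalRightMove? : ∀ X Y → Decidable (LegalRightMove X Y)
  legalRightMove? X Y y = ¬? (y ∈? Y) ×-dec isFace? X (Y ∪ ⁅ y ⁆)

  leftOption-gameFrom : ∀ {P : Game → Set} f X Y →
    (∀ x → LegalLeftMove X Y x → P (gameFrom C f (X ∪ ⁅ x ⁆) Y)) →
    ∀ i → P (leftOption (gameFrom C (suc f) X Y) i)
  leftOption-gameFrom f X Y h i =
    h _ (proj₂ (∈-filter⁻ (legalLeftMove? X Y) {xs = allFin nL} (∈-lookup i)))

  rightOption-gameFrom : ∀ {P : Game → Set} f X Y →
    (∀ y → LegalRightMove X Y y → P (gameFrom C f X (Y ∪ ⁅ y ⁆))) →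
    ∀ j → P (rightOption (gameFrom C (suc f) X Y) j)
  rightOption-gameFrom f X Y h j =
    h _ (proj₂ (∈-filter⁻ (legalRightMove? X Y) {xs = allFin nR} (∈-lookup j)))

  leftEnd-gameFrom : ∀ f X Y → (∀ x → ¬ LegalLeftMove X Y x) → LeftEnd (gameFrom C f X Y)
  leftEnd-gameFrom zero    X Y noMove ()
  leftEnd-gameFrom (suc f) X Y noMove = leftOption-gameFrom f X Y noMove

  rightEnd-gameFrom : ∀ f X Y → (∀ y → ¬ LegalRightMove X Y y) → RightEnd (gameFrom C f X Y)
  rightEnd-gameFrom zero    X Y noMove ()
  rightEnd-gameFrom (suc f) X Y noMove = rightOption-gameFrom f X Y noMove

  leftWinsFirst-gameFrom-⊕ : ∀ f X Y H x → LegalLeftMove X Y x →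
    LeftWinsSecond (gameFrom C f (X ∪ ⁅ x ⁆) Y ⊕ H) → LeftWinsFirst (gameFrom C (suc f) X Y ⊕ H)
  leftWinsFirst-gameFrom-⊕ f X Y H x legal w =
    leftWinsFirst-⊕ˡ (gameFrom C (suc f) X Y) H (index x∈moves)
      (subst (λ x → LeftWinsSecond (gameFrom C f (X ∪ ⁅ x ⁆) Y ⊕ H)) (lookup-index x∈moves) w)
    where x∈moves = ∈-filter⁺ (legalLeftMove? X Y) (∈-allFin x) legal

  rightWinsFirst-gameFrom-⊕ : ∀ f X Y H y → LegalRightMove X Y y →
    RightWinsSecond (gameFrom C f X (Y ∪ ⁅ y ⁆) ⊕ H) → RightWinsFirst (gameFrom C (suc f) X Y ⊕ H)
  rightWinsFirst-gameFrom-⊕ f X Y H y legal w =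
    rightWinsFirst-⊕ˡ (gameFrom C (suc f) X Y) H (index y∈moves)
      (subst (λ y → RightWinsSecond (gameFrom C f X (Y ∪ ⁅ y ⁆) ⊕ H)) (lookup-index y∈moves) w)
    where y∈moves = ∈-filter⁺ (legalRightMove? X Y) (∈-allFin y) legal

∣∁⊥∣≡n : ∀ n → ∣ ∁ (⊥ {n}) ∣ ≡ n
∣∁⊥∣≡n zero    = refl
∣∁⊥∣≡n (suc n) = cong suc (∣∁⊥∣≡n n)

∣∁p∣≡0⇒x∈p : ∀ {n} {p : Subset n} → ∣ ∁ p ∣ ≡ 0 → ∀ x → x ∈ p
∣∁p∣≡0⇒x∈p {p = inside ∷ p} eq zero    = here
∣∁p∣≡0⇒x∈p {p = inside ∷ p} eq (suc x) = there (∣∁p∣≡0⇒x∈p eq x)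

∣∁p∣≡1+m⇒∃∉ : ∀ {n m} {p : Subset n} → ∣ ∁ p ∣ ≡ suc m → ∃ (_∉ p)
∣∁p∣≡1+m⇒∃∉ {p = outside ∷ p} eq = zero , λ ()
∣∁p∣≡1+m⇒∃∉ {p = inside ∷ p}  eq with x , x∉p ← ∣∁p∣≡1+m⇒∃∉ eq = suc x , λ { (there x∈p) → x∉p x∈p }

x∉p⇒∣∁p∣≡1+∣∁[p∪⁅x⁆]∣ : ∀ {n} {p : Subset n} {x} → x ∉ p → ∣ ∁ p ∣ ≡ suc ∣ ∁ (p ∪ ⁅ x ⁆) ∣
x∉p⇒∣∁p∣≡1+∣∁[p∪⁅x⁆]∣ {p = inside ∷ p}  {zero}  x∉p = ⊥-elim (x∉p here)
x∉p⇒∣∁p∣≡1+∣∁[p∪⁅x⁆]∣ {p = outside ∷ p} {zero}  x∉p = cong (suc ∘ ∣_∣ ∘ ∁) (sym (∪-identityʳ p))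
x∉p⇒∣∁p∣≡1+∣∁[p∪⁅x⁆]∣ {p = inside ∷ p}  {suc x} x∉p = x∉p⇒∣∁p∣≡1+∣∁[p∪⁅x⁆]∣ (x∉p ∘ there)
x∉p⇒∣∁p∣≡1+∣∁[p∪⁅x⁆]∣ {p = outside ∷ p} {suc x} x∉p = cong suc (x∉p⇒∣∁p∣≡1+∣∁[p∪⁅x⁆]∣ (x∉p ∘ there))

x∈⊥∪⁅x⁆ : ∀ {n} (x : Fin n) → x ∈ ⊥ ∪ ⁅ x ⁆
x∈⊥∪⁅x⁆ x = q⊆p∪q ⊥ ⁅ x ⁆ (x∈⁅x⁆ x)

module _ {k b} (S : Fin k → Subset b) where

  leftSingletonComplex : Complex
  leftSingletonComplex = ⟨ (λ i → ⁅ i ⁆ , S i) ⟩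

  private
    C = leftSingletonComplex

  noLeftMove-occupied : ∀ {X Y x} x' → x ∈ X → ¬ LegalLeftMove C X Y x'
  noLeftMove-occupied {X} x' x∈X (x'∉X , j , X∪x'⊆j , _) =
    x'∉X (subst (_∈ X) (trans (x∈⁅y⁆⇒x≡y j (X∪x'⊆j (p⊆p∪q ⁅ x' ⁆ x∈X)))
                              (sym (x∈⁅y⁆⇒x≡y j (X∪x'⊆j (q⊆p∪q X ⁅ x' ⁆ (x∈⁅x⁆ x'))))))
                       x∈X)

  noRightMove-saturated : ∀ {X Y x} y → x ∈ X → S x ⊆ Y → ¬ LegalRightMove C X Y y
  noRightMove-saturated {Y = Y} y x∈X Sx⊆Y (y∉Y , j , X⊆j , Y∪y⊆Sj) =
    y∉Y (Sx⊆Y (subst (λ i → y ∈ S i) (sym (x∈⁅y⁆⇒x≡y j (X⊆j x∈X))) (Y∪y⊆Sj (q⊆p∪q Y ⁅ y ⁆ (x∈⁅x⁆ y)))))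

  legalLeftMove-⊥ : ∀ {Y} x → Y ⊆ S x → LegalLeftMove C ⊥ Y x
  legalLeftMove-⊥ x Y⊆Sx = ∉⊥ , x , ⊆-reflexive (∪-identityˡ ⁅ x ⁆) , Y⊆Sx

  legalRightMove-⊥ : ∀ {Y} y j → y ∉ Y → Y ∪ ⁅ y ⁆ ⊆ S j → LegalRightMove C ⊥ Y y
  legalRightMove-⊥ y j y∉Y Y∪y⊆Sj = y∉Y , j , ⊆-min ⁅ j ⁆ , Y∪y⊆Sj

  module _ (S-surjective : Surjective _≡_ _≡_ S) where

    preimage : ∀ Y → ∃ λ x → S x ≡ Y
    preimage Y = proj₁ (S-surjective Y) , proj₂ (S-surjective Y) refl

    leftWinsFirst-⊕-neg-zero : ∀ f Y → LeftWinsFirst (gameFrom C (suc f) ⊥ Y ⊕ neg zeroG)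
    leftWinsFirst-⊕-neg-zero f Y with x , Sx≡Y ← preimage Y =
      leftWinsFirst-gameFrom-⊕ C f ⊥ Y (neg zeroG) x (legalLeftMove-⊥ x (⊆-reflexive (sym Sx≡Y)))
        (rightEnd⇒leftWinsSecond-⊕-neg-zero (gameFrom C f (⊥ ∪ ⁅ x ⁆) Y)
          (rightEnd-gameFrom C f (⊥ ∪ ⁅ x ⁆) Y λ y → noRightMove-saturated y (x∈⊥∪⁅x⁆ x) (⊆-reflexive Sx≡Y)))

    gameFrom-⊥-≥-dyadic : ∀ m f Y → ∣ ∁ Y ∣ ≡ m → m < f →
      LeftWinsSecond (gameFrom C f ⊥ Y ⊕ neg (dyadic m))
    gameFrom-⊥-≥-dyadic m (suc f) Y missing (s≤s m≤f) =
      leftWinsSecond-⊕ (gameFrom C (suc f) ⊥ Y) (neg (dyadic m))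
        (rightOption-gameFrom C {λ G → LeftWinsFirst (G ⊕ neg (dyadic m))} f ⊥ Y
          λ y (y∉Y , _) → answerRightVertex m missing m≤f y y∉Y)
        (answerNegZero m)
      where
      answerRightVertex : ∀ m → ∣ ∁ Y ∣ ≡ m → m ≤ f → ∀ y → y ∉ Y →
        LeftWinsFirst (gameFrom C f ⊥ (Y ∪ ⁅ y ⁆) ⊕ neg (dyadic m))
      answerRightVertex zero    missing _   y y∉Y = ⊥-elim (y∉Y (∣∁p∣≡0⇒x∈p missing y))
      answerRightVertex (suc m) missing m<f y y∉Y =
        leftWinsFirst-⊕ʳ _ (neg (dyadic (suc m))) zero
          (gameFrom-⊥-≥-dyadic m f (Y ∪ ⁅ y ⁆) (suc-injective (trans (sym (x∉p⇒∣∁p∣≡1+∣∁[p∪⁅x⁆]∣ y∉Y)) missing)) m<f)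
      answerNegZero : ∀ m j → LeftWinsFirst (gameFrom C (suc f) ⊥ Y ⊕ rightOption (neg (dyadic m)) j)
      answerNegZero zero    _ = leftWinsFirst-⊕-neg-zero f Y
      answerNegZero (suc m) _ = leftWinsFirst-⊕-neg-zero f Y

    gameFrom-⊥-≤-dyadic : ∀ m f Y → ∣ ∁ Y ∣ ≡ m → m < f →
      RightWinsSecond (gameFrom C f ⊥ Y ⊕ neg (dyadic m))
    gameFrom-⊥-≤-dyadic m (suc f) Y missing (s≤s m≤f) =
      rightWinsSecond-⊕ (gameFrom C (suc f) ⊥ Y) (neg (dyadic m))
        (leftOption-gameFrom C {λ G → RightWinsFirst (G ⊕ neg (dyadic m))} f ⊥ Y λ x _ →
          rightWinsFirst-⊕-neg-dyadic _ m (leftEnd⇒rightWinsSecond-⊕-neg-zero (gameFrom C f (⊥ ∪ ⁅ x ⁆) Y)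
            (leftEnd-gameFrom C f (⊥ ∪ ⁅ x ⁆) Y λ x' → noLeftMove-occupied x' (x∈⊥∪⁅x⁆ x))))
        (answerNegDyadic m missing m≤f)
      where
      answerNegDyadic : ∀ m → ∣ ∁ Y ∣ ≡ m → m ≤ f → ∀ i →
        RightWinsFirst (gameFrom C (suc f) ⊥ Y ⊕ leftOption (neg (dyadic m)) i)
      answerNegDyadic zero    _       _   ()
      answerNegDyadic (suc m) missing m<f _ =
        let y , y∉Y = ∣∁p∣≡1+m⇒∃∉ {p = Y} missing
            j , Sj≡Y∪y = preimage (Y ∪ ⁅ y ⁆)
        in rightWinsFirst-gameFrom-⊕ C f ⊥ Y (neg (dyadic m)) y (legalRightMove-⊥ y j y∉Y (⊆-reflexive (sym Sj≡Y∪y)))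
             (gameFrom-⊥-≤-dyadic m f (Y ∪ ⁅ y ⁆) (suc-injective (trans (sym (x∉p⇒∣∁p∣≡1+∣∁[p∪⁅x⁆]∣ y∉Y)) missing)) m<f)

mainTheorem7 : (n : ℕ) (S : Fin (2 ^ n) → Subset n) → Bijective _≡_ _≡_ S →
    spGame ⟨ (λ i → ⁅ i ⁆ , S i) ⟩ ≈G dyadic n
mainTheorem7 n S (_ , S-surjective) =
  gameFrom-⊥-≥-dyadic S S-surjective n fuel ⊥ (∣∁⊥∣≡n n) n<fuel ,
  gameFrom-⊥-≤-dyadic S S-surjective n fuel ⊥ (∣∁⊥∣≡n n) n<fuel
  where
  fuel : ℕ
  fuel = 2 ^ n + n
  n<fuel : n < fuel
  n<fuel = m<n+m n (m^n>0 2 n)
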